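{- Let $H$ be an even $3$--hypergraph. Then $\omega(H)\geq \omega(\mathrm{link}_H(v))+1$ for every $v\in V(H)$.
   Context: A $3$--hypergraph $H$ has a finite vertex set $V(H)$ and edge set $E(H)\subseteq\binom{V(H)}{3}$; $\omega(H)$ is the largest size of a subset of $V(H)$ all of whose $3$-element subsets are edges. $H$ is even if every $4$-element subset of $V(H)$ contains an even number of edges of $H$. For $v\in V(H)$, $\mathrm{link}_H(v)$ is the simple graph with vertex set $\{w\neq v : \{v,w\}\subset e \text{ for some } e\in E(H)\}$ and edge set $\{\{u,w\}: \{v,u,w\}\in E(H)\}$; $\omega$ of a graph is its usual clique number. -}

module Defs where

open import Data.Bool using (Bool; true; false; _∧_; _∨_; not; T)
open import Data.Nat using (ℕ; zero; suc; _⊔_; _≡ᵇ_; _%_)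
open import Data.Fin using (Fin)
open import Data.Fin.Properties using () renaming (_≟_ to _≟ᶠ_)
open import Data.Vec using (Vec; []; _∷_; lookup; zipWith)
open import Data.List using (List; []; _∷_; map; filter; _++_; length; foldr)
open import Data.Bool.ListAction using (all; any)
open import Data.Fin.Subset using (Subset; inside; outside; ∣_∣; ⁅_⁆; _∪_)
open import Relation.Nullary.Decidable using (⌊_⌋)
open import Relation.Binary.PropositionalEquality using (_≡_)

allSubsets : (n : ℕ) → List (Subset n)
allSubsets zero = [] ∷ []
allSubsets (suc n) = map (outside ∷_) (allSubsets n) ++ map (inside ∷_) (allSubsets n)

_∈ᵇ_ : ∀ {n} → Fin n → Subset n → Bool
i ∈ᵇ s = lookup s i

_⊆ᵇ_ : ∀ {n} → Subset n → Subset n → Bool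
[] ⊆ᵇ [] = true
(x ∷ xs) ⊆ᵇ (y ∷ ys) = (not x ∨ y) ∧ (xs ⊆ᵇ ys)

_≟ᵇ_ : ∀ {n} → Fin n → Fin n → Bool
i ≟ᵇ j = ⌊ i ≟ᶠ j ⌋

maxList : List ℕ → ℕ
maxList = foldr _⊔_ 0

record Hypergraph3 (n : ℕ) : Set where
  field
    edge      : Subset n → Bool
    edge-size : ∀ s → T (edge s) → ∣ s ∣ ≡ 3
open Hypergraph3 public

edgesIn : ∀ {n} → Hypergraph3 n → Subset n → ℕ
edgesIn {n} H S = length (filter (λ t → T? (t ⊆ᵇ S ∧ edge H t)) (allSubsets n))
  where
  open import Data.Bool.Properties using () renaming (T? to T?)

IsEven : ∀ {n} → Hypergraph3 n → Set
IsEven {n} H = ∀ (S : Subset n) → ∣ S ∣ ≡ 4 → edgesIn H S % 2 ≡ 0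

isCliqueᴴ : ∀ {n} → Hypergraph3 n → Subset n → Bool
isCliqueᴴ {n} H s = all (λ t → not (t ⊆ᵇ s ∧ (∣ t ∣ ≡ᵇ 3)) ∨ edge H t) (allSubsets n)

ωᴴ : ∀ {n} → Hypergraph3 n → ℕ
ωᴴ {n} H = maxList (map ∣_∣ (filter (λ s → T? (isCliqueᴴ H s)) (allSubsets n)))
  where
  open import Data.Bool.Properties using () renaming (T? to T?)

record Graph (n : ℕ) : Set where
  field
    verts : Subset n
    adj   : Fin n → Fin n → Bool
open Graph public

isCliqueᴳ : ∀ {n} → Graph n → Subset n → Bool
isCliqueᴳ {n} G C =
  (C ⊆ᵇ verts G) ∧
  all (λ u → all (λ w → not (u ∈ᵇ C ∧ w ∈ᵇ C ∧ not (u ≟ᵇ w)) ∨ adj G u w)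
                 (Data.List.allFin n)) (Data.List.allFin n)
  where import Data.List

ωᴳ : ∀ {n} → Graph n → ℕ
ωᴳ {n} G = maxList (map ∣_∣ (filter (λ s → T? (isCliqueᴳ G s)) (allSubsets n)))
  where
  open import Data.Bool.Properties using () renaming (T? to T?)

link : ∀ {n} → Hypergraph3 n → Fin n → Graph n
link {n} H v = record
  { verts = linkVerts
  ; adj   = λ u w → not (u ≟ᵇ w) ∧ edge H (⁅ v ⁆ ∪ ⁅ u ⁆ ∪ ⁅ w ⁆)
  }
  where
  linkVerts : Subset n
  linkVerts = Data.Vec.tabulate (λ w → not (v ≟ᵇ w) ∧
                any (λ e → edge H e ∧ v ∈ᵇ e ∧ w ∈ᵇ e) (allSubsets n))
    where import Data.Vec

-- Let C be a clique of link(v). Every triple {v,a,b} with a,b ∈ C is an edge by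
-- definition of the link, and a triple t ⊆ C is an edge by parity: the 4-set
-- {v} ∪ t has at least the three edges through v, so evenness forces the fourth
-- triple t to be an edge as well. Hence {v} ∪ C is a clique of H of size |C| + 1.
module Submission where

open import Defs
open import Data.Bool.ListAction using (any)
open import Data.Bool using (Bool; true; false; T; not; _∧_; _∨_)
open import Data.Bool.Properties using (T?; T-∧; T-≡) renaming (_≟_ to _≟ᴮ_)
open import Data.Fin using (Fin; zero; suc)
open import Data.Fin.Properties using (_≟_)
open import Data.Fin.Subset
  using (Subset; inside; outside; _∈_; _∉_; _⊆_; ⁅_⁆; _∪_; _-_; ∣_∣; ⊥)
open import Data.Fin.Subset.Properties
  using (_∈?_; nonempty?; Empty-unique; drop-not-there; drop-∷-⊆; ⊆-antisym; ⊆-trans;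
         p⊆q⇒∣p∣≤∣q∣; x∈⁅x⁆; x∈⁅y⁆⇒x≡y; x∈p∪q⁺; x∈p∪q⁻; q⊆p∪q; p─q⊆p;
         x∈p∧x≢y⇒x∈p-y; ∪-identityˡ; ∪-identityʳ; ∣⊥∣≡0; ∉⊥)
open import Data.List using (List; []; _∷_; _++_; map; filterᵇ; length)
open import Data.List.Properties using (filter-++; length-++; filter-none; filter-≐)
open import Data.List.Membership.Propositional using () renaming (_∈_ to _∈ˡ_)
open import Data.List.Membership.Propositional.Properties
  using (∈-++⁺ˡ; ∈-++⁺ʳ; ∈-map⁺; ∈-filter⁺; ∈-allFin)
open import Data.List.Relation.Unary.All as All using (All; []; _∷_)
open import Data.List.Relation.Unary.All.Properties using (all⁺; all⁻; all-filter; map⁺)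
import Data.List.Relation.Unary.Any as Any
open import Data.Nat using (ℕ; zero; suc; _+_; _≤_; _<_; _%_; _≡ᵇ_; s≤s)
open import Data.Nat.Properties
  using (suc-injective; +-suc; +-comm; +-identityʳ; ≤-trans; ≤-reflexive; ≤⇒≯;
         m≤m⊔n; m≤n⊔m; ⊔-lub; ≡ᵇ⇒≡; ≡⇒≡ᵇ; 1+n≢0)
open import Data.Nat.Combinatorics using (_C_; nCk+nC[k+1]≡[n+1]C[k+1])
open import Data.Product using (∃; ∃₂; _×_; _,_; proj₁; proj₂)
open import Data.Sum using (inj₁; inj₂)
open import Data.Vec using ([]; _∷_; here; there)
open import Data.Vec.Properties using (≡-dec; []=⇒lookup; lookup∘tabulate)
open import Function using (_∘_; Equivalence)
open import Relation.Binary.Definitions using (DecidableEquality)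
open import Relation.Nullary using (¬_; yes; no; does; contradiction)
open import Relation.Nullary.Decidable using (fromWitnessFalse; toWitnessFalse)
open import Relation.Binary.PropositionalEquality
  using (_≡_; _≢_; refl; sym; trans; cong; cong₂; subst; module ≡-Reasoning)

open Equivalence using (to; from)

T-not-∨⁺ : ∀ {b c} → (T b → T c) → T (not b ∨ c)
T-not-∨⁺ {false} _   = _
T-not-∨⁺ {true}  b⇒c = b⇒c _

T-not-∨⁻ : ∀ {b c} → T (not b ∨ c) → T b → T c
T-not-∨⁻ {true} c _ = c

_≟ˢ_ : ∀ {n} → DecidableEquality (Subset n)
_≟ˢ_ = ≡-dec _≟ᴮ_

x∉p-x : ∀ {n} {p : Subset n} x → x ∉ p - x
x∉p-x {p = _ ∷ _} zero    ()
x∉p-x {p = _ ∷ _} (suc x) (there x∈p-x) = x∉p-x x x∈p-x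

⁅x⁆∪[p-x]≡p : ∀ {n} {p : Subset n} {x} → x ∈ p → ⁅ x ⁆ ∪ (p - x) ≡ p
⁅x⁆∪[p-x]≡p {p = p} {x} x∈p = ⊆-antisym ⊆p ⊇p
  where
  ⊆p : ⁅ x ⁆ ∪ (p - x) ⊆ p
  ⊆p y∈ with x∈p∪q⁻ ⁅ x ⁆ (p - x) y∈
  ... | inj₁ y∈⁅x⁆ = subst (_∈ p) (sym (x∈⁅y⁆⇒x≡y x y∈⁅x⁆)) x∈p
  ... | inj₂ y∈p-x = p─q⊆p p ⁅ x ⁆ y∈p-x
  ⊇p : p ⊆ ⁅ x ⁆ ∪ (p - x)
  ⊇p {y} y∈p with y ≟ x
  ... | yes refl = x∈p∪q⁺ (inj₁ (x∈⁅x⁆ x))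
  ... | no y≢x   = x∈p∪q⁺ (inj₂ (x∈p∧x≢y⇒x∈p-y y∈p y≢x))

∣⁅x⁆∪p∣≡1+∣p∣ : ∀ {n} {x : Fin n} {p} → x ∉ p → ∣ ⁅ x ⁆ ∪ p ∣ ≡ suc ∣ p ∣
∣⁅x⁆∪p∣≡1+∣p∣ {x = zero}  {inside  ∷ p} x∉p = contradiction here x∉p
∣⁅x⁆∪p∣≡1+∣p∣ {x = zero}  {outside ∷ p} _   = cong (suc ∘ ∣_∣) (∪-identityˡ p)
∣⁅x⁆∪p∣≡1+∣p∣ {x = suc x} {inside  ∷ p} x∉p = cong suc (∣⁅x⁆∪p∣≡1+∣p∣ (drop-not-there x∉p))
∣⁅x⁆∪p∣≡1+∣p∣ {x = suc x} {outside ∷ p} x∉p = ∣⁅x⁆∪p∣≡1+∣p∣ (drop-not-there x∉p)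

∣p∣≡1+∣p-x∣ : ∀ {n} {p : Subset n} {x} → x ∈ p → ∣ p ∣ ≡ suc ∣ p - x ∣
∣p∣≡1+∣p-x∣ {x = x} x∈p = trans (cong ∣_∣ (sym (⁅x⁆∪[p-x]≡p x∈p))) (∣⁅x⁆∪p∣≡1+∣p∣ (x∉p-x x))

∣p∣≡0⇒p≡⊥ : ∀ {n} {p : Subset n} → ∣ p ∣ ≡ 0 → p ≡ ⊥
∣p∣≡0⇒p≡⊥ ∣p∣≡0 = Empty-unique λ (_ , x∈p) → 1+n≢0 (trans (sym (∣p∣≡1+∣p-x∣ x∈p)) ∣p∣≡0)

∣p∣≡1+k⇒∃∈ : ∀ {n k} {p : Subset n} → ∣ p ∣ ≡ suc k → ∃ λ x → x ∈ p × ∣ p - x ∣ ≡ k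
∣p∣≡1+k⇒∃∈ {n} {p = p} ∣p∣≡1+k with nonempty? p
... | yes (x , x∈p) = x , x∈p , suc-injective (trans (sym (∣p∣≡1+∣p-x∣ x∈p)) ∣p∣≡1+k)
... | no p-empty    =
  contradiction (trans (sym ∣p∣≡1+k) (trans (cong ∣_∣ (Empty-unique p-empty)) (∣⊥∣≡0 n))) 1+n≢0

∣p∣≡2⇒p≡⁅a⁆∪⁅b⁆ : ∀ {n} {p : Subset n} → ∣ p ∣ ≡ 2 → ∃₂ λ a b → a ≢ b × p ≡ ⁅ a ⁆ ∪ ⁅ b ⁆
∣p∣≡2⇒p≡⁅a⁆∪⁅b⁆ {p = p} ∣p∣≡2 with ∣p∣≡1+k⇒∃∈ ∣p∣≡2
... | a , a∈p , ∣p-a∣≡1 with ∣p∣≡1+k⇒∃∈ ∣p-a∣≡1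
... | b , b∈p-a , ∣p-a-b∣≡0 = a , b , a≢b , p≡⁅a⁆∪⁅b⁆
  where
  open ≡-Reasoning
  a≢b : a ≢ b
  a≢b refl = x∉p-x a b∈p-a
  p≡⁅a⁆∪⁅b⁆ : p ≡ ⁅ a ⁆ ∪ ⁅ b ⁆
  p≡⁅a⁆∪⁅b⁆ = begin
    p                           ≡⟨ ⁅x⁆∪[p-x]≡p a∈p ⟨
    ⁅ a ⁆ ∪ (p - a)             ≡⟨ cong (⁅ a ⁆ ∪_) (⁅x⁆∪[p-x]≡p b∈p-a) ⟨
    ⁅ a ⁆ ∪ ⁅ b ⁆ ∪ (p - a - b) ≡⟨ cong (λ q → ⁅ a ⁆ ∪ ⁅ b ⁆ ∪ q) (∣p∣≡0⇒p≡⊥ ∣p-a-b∣≡0) ⟩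
    ⁅ a ⁆ ∪ ⁅ b ⁆ ∪ ⊥           ≡⟨ cong (⁅ a ⁆ ∪_) (∪-identityʳ ⁅ b ⁆) ⟩
    ⁅ a ⁆ ∪ ⁅ b ⁆               ∎

⊆∧∣q∣≤∣p∣⇒p≡q : ∀ {n} {p q : Subset n} → p ⊆ q → ∣ q ∣ ≤ ∣ p ∣ → p ≡ q
⊆∧∣q∣≤∣p∣⇒p≡q {p = []}          {[]}          _   _         = refl
⊆∧∣q∣≤∣p∣⇒p≡q {p = inside  ∷ _} {inside  ∷ _} p⊆q (s≤s q≤p) =
  cong (inside ∷_) (⊆∧∣q∣≤∣p∣⇒p≡q (drop-∷-⊆ p⊆q) q≤p)
⊆∧∣q∣≤∣p∣⇒p≡q {p = inside  ∷ _} {outside ∷ _} p⊆q _ with p⊆q here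
... | ()
⊆∧∣q∣≤∣p∣⇒p≡q {p = outside ∷ _} {inside  ∷ _} p⊆q q<p =
  contradiction q<p (≤⇒≯ (p⊆q⇒∣p∣≤∣q∣ (drop-∷-⊆ p⊆q)))
⊆∧∣q∣≤∣p∣⇒p≡q {p = outside ∷ _} {outside ∷ _} p⊆q q≤p =
  cong (outside ∷_) (⊆∧∣q∣≤∣p∣⇒p≡q (drop-∷-⊆ p⊆q) q≤p)

p⊆⁅x⁆∪q∧x∉p⇒p⊆q : ∀ {n} {p q : Subset n} {x} → p ⊆ ⁅ x ⁆ ∪ q → x ∉ p → p ⊆ q
p⊆⁅x⁆∪q∧x∉p⇒p⊆q {q = q} {x} p⊆xq x∉p y∈p with x∈p∪q⁻ ⁅ x ⁆ q (p⊆xq y∈p)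
... | inj₁ y∈⁅x⁆ = contradiction (subst (_∈ _) (x∈⁅y⁆⇒x≡y x y∈⁅x⁆) y∈p) x∉p
... | inj₂ y∈q   = y∈q

⁅x⁆∪-monoʳ : ∀ {n} {p q : Subset n} x → p ⊆ q → ⁅ x ⁆ ∪ p ⊆ ⁅ x ⁆ ∪ q
⁅x⁆∪-monoʳ {p = p} x p⊆q y∈ with x∈p∪q⁻ ⁅ x ⁆ p y∈
... | inj₁ y∈⁅x⁆ = x∈p∪q⁺ (inj₁ y∈⁅x⁆)
... | inj₂ y∈p   = x∈p∪q⁺ (inj₂ (p⊆q y∈p))

∈⇒∈ᵇ : ∀ {n} {x : Fin n} {p} → x ∈ p → T (x ∈ᵇ p)
∈⇒∈ᵇ x∈p = from T-≡ ([]=⇒lookup x∈p)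

⊆ᵇ⇒⊆ : ∀ {n} {p q : Subset n} → T (p ⊆ᵇ q) → p ⊆ q
⊆ᵇ⇒⊆ {p = inside ∷ _} {inside ∷ _} _ here = here
⊆ᵇ⇒⊆ {p = _ ∷ _} {_ ∷ _} p⊆q (there x∈p) = there (⊆ᵇ⇒⊆ (proj₂ (to T-∧ p⊆q)) x∈p)

⊆⇒⊆ᵇ : ∀ {n} {p q : Subset n} → p ⊆ q → T (p ⊆ᵇ q)
⊆⇒⊆ᵇ {p = []}          {[]}          _   = _
⊆⇒⊆ᵇ {p = outside ∷ _} {_ ∷ _}       p⊆q = ⊆⇒⊆ᵇ (drop-∷-⊆ p⊆q)
⊆⇒⊆ᵇ {p = inside  ∷ _} {inside  ∷ _} p⊆q = ⊆⇒⊆ᵇ (drop-∷-⊆ p⊆q)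
⊆⇒⊆ᵇ {p = inside  ∷ _} {outside ∷ _} p⊆q with p⊆q here
... | ()

countᵇ : ∀ {A : Set} → (A → Bool) → List A → ℕ
countᵇ f = length ∘ filterᵇ f

module _ {A : Set} where

  countᵇ-++ : ∀ (f : A → Bool) xs ys → countᵇ f (xs ++ ys) ≡ countᵇ f xs + countᵇ f ys
  countᵇ-++ f xs ys = trans (cong length (filter-++ (T? ∘ f) xs ys)) (length-++ (filterᵇ f xs))

  countᵇ-map : ∀ {B : Set} (f : B → Bool) (g : A → B) xs → countᵇ f (map g xs) ≡ countᵇ (f ∘ g) xs
  countᵇ-map f g []       = refl
  countᵇ-map f g (x ∷ xs) with f (g x)
  ... | true  = cong suc (countᵇ-map f g xs)
  ... | false = countᵇ-map f g xs

  countᵇ-cong : ∀ {f g : A → Bool} → (∀ {x} → T (f x) → T (g x)) → (∀ {x} → T (g x) → T (f x)) →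
                ∀ xs → countᵇ f xs ≡ countᵇ g xs
  countᵇ-cong {f} {g} f⇒g g⇒f = cong length ∘ filter-≐ (T? ∘ f) (T? ∘ g) (f⇒g , g⇒f)

  countᵇ-none : ∀ {f : A → Bool} → (∀ x → ¬ T (f x)) → ∀ xs → countᵇ f xs ≡ 0
  countᵇ-none {f} ¬f xs = cong length (filter-none (T? ∘ f) (All.universal ¬f xs))

  countᵇ-split : ∀ (f g : A → Bool) xs →
                 countᵇ f xs ≡ countᵇ (λ x → f x ∧ g x) xs + countᵇ (λ x → f x ∧ not (g x)) xs
  countᵇ-split f g []       = refl
  countᵇ-split f g (x ∷ xs) with f x | g x
  ... | false | _     = countᵇ-split f g xs
  ... | true  | true  = cong suc (countᵇ-split f g xs)
  ... | true  | false = trans (cong suc (countᵇ-split f g xs)) (sym (+-suc _ _))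

∈-allSubsets : ∀ {n} (s : Subset n) → s ∈ˡ allSubsets n
∈-allSubsets []                    = Any.here refl
∈-allSubsets {suc n} (outside ∷ s) = ∈-++⁺ˡ (∈-map⁺ (outside ∷_) (∈-allSubsets s))
∈-allSubsets {suc n} (inside  ∷ s) =
  ∈-++⁺ʳ (map (outside ∷_) (allSubsets n)) (∈-map⁺ (inside ∷_) (∈-allSubsets s))

countᵇ-allSubsets-suc : ∀ n (f : Subset (suc n) → Bool) →
  countᵇ f (allSubsets (suc n)) ≡
  countᵇ (f ∘ (outside ∷_)) (allSubsets n) + countᵇ (f ∘ (inside ∷_)) (allSubsets n)
countᵇ-allSubsets-suc n f =
  trans (countᵇ-++ f (map (outside ∷_) (allSubsets n)) (map (inside ∷_) (allSubsets n)))
        (cong₂ _+_ (countᵇ-map f (outside ∷_) (allSubsets n))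
                   (countᵇ-map f (inside ∷_) (allSubsets n)))

-- Stated with does rather than ⌊_⌋, which gets stuck on (x ∷ s) ≟ˢ (x ∷ t).
countᵇ-≟-allSubsets : ∀ n (t : Subset n) → countᵇ (λ s → does (s ≟ˢ t)) (allSubsets n) ≡ 1
countᵇ-≟-allSubsets zero    []            = refl
countᵇ-≟-allSubsets (suc n) (outside ∷ t) = trans (countᵇ-allSubsets-suc n _)
  (cong₂ _+_ (countᵇ-≟-allSubsets n t) (countᵇ-none (λ _ ()) (allSubsets n)))
countᵇ-≟-allSubsets (suc n) (inside  ∷ t) = trans (countᵇ-allSubsets-suc n _)
  (cong₂ _+_ (countᵇ-none (λ _ ()) (allSubsets n)) (countᵇ-≟-allSubsets n t))

countᵇ-⊆∧∣∣≡-allSubsets : ∀ n (S : Subset n) k →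
  countᵇ (λ s → s ⊆ᵇ S ∧ (∣ s ∣ ≡ᵇ k)) (allSubsets n) ≡ ∣ S ∣ C k
countᵇ-⊆∧∣∣≡-allSubsets zero    []            zero    = refl
countᵇ-⊆∧∣∣≡-allSubsets zero    []            (suc k) = refl
countᵇ-⊆∧∣∣≡-allSubsets (suc n) (outside ∷ S) k       = trans (countᵇ-allSubsets-suc n _)
  (trans (cong₂ _+_ (countᵇ-⊆∧∣∣≡-allSubsets n S k) (countᵇ-none (λ _ ()) (allSubsets n)))
         (+-identityʳ _))
countᵇ-⊆∧∣∣≡-allSubsets (suc n) (inside  ∷ S) zero    = trans (countᵇ-allSubsets-suc n _)
  (cong₂ _+_ (countᵇ-⊆∧∣∣≡-allSubsets n S 0) (countᵇ-none (λ _ → proj₂ ∘ to T-∧) (allSubsets n)))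
countᵇ-⊆∧∣∣≡-allSubsets (suc n) (inside  ∷ S) (suc k) = trans (countᵇ-allSubsets-suc n _)
  (trans (+-comm (countᵇ _ (allSubsets n)) _)
  (trans (cong₂ _+_ (countᵇ-⊆∧∣∣≡-allSubsets n S k) (countᵇ-⊆∧∣∣≡-allSubsets n S (suc k)))
         (nCk+nC[k+1]≡[n+1]C[k+1] ∣ S ∣ k)))

x∈xs⇒x≤maxList : ∀ {x xs} → x ∈ˡ xs → x ≤ maxList xs
x∈xs⇒x≤maxList (Any.here refl)  = m≤m⊔n _ _
x∈xs⇒x≤maxList (Any.there x∈xs) = ≤-trans (x∈xs⇒x≤maxList x∈xs) (m≤n⊔m _ _)

maxList< : ∀ {w xs} → 0 < w → All (_< w) xs → maxList xs < w
maxList< 0<w []           = 0<w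
maxList< 0<w (x<w ∷ xs<w) = ⊔-lub x<w (maxList< 0<w xs<w)

module _ {n : ℕ} (H : Hypergraph3 n) where

  isCliqueᴴ⁺ : ∀ {S} → (∀ {t} → t ⊆ S → ∣ t ∣ ≡ 3 → T (edge H t)) → T (isCliqueᴴ H S)
  isCliqueᴴ⁺ {S} triples = all⁻ _ (All.universal triple (allSubsets n))
    where
    triple : ∀ t → T (not (t ⊆ᵇ S ∧ (∣ t ∣ ≡ᵇ 3)) ∨ edge H t)
    triple t = T-not-∨⁺ λ h → let t⊆S , ∣t∣≡3 = to T-∧ h in triples (⊆ᵇ⇒⊆ t⊆S) (≡ᵇ⇒≡ _ _ ∣t∣≡3)

  isCliqueᴴ⇒∣S∣≤ωᴴ : ∀ {S} → T (isCliqueᴴ H S) → ∣ S ∣ ≤ ωᴴ H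
  isCliqueᴴ⇒∣S∣≤ωᴴ {S} S-clique =
    x∈xs⇒x≤maxList (∈-map⁺ ∣_∣ (∈-filter⁺ (T? ∘ isCliqueᴴ H) (∈-allSubsets S) S-clique))

  edgesIn≡3 : ∀ {S t} → ∣ S ∣ ≡ 4 → t ⊆ S → ∣ t ∣ ≡ 3 → ¬ T (edge H t) →
              (∀ {s} → s ⊆ S → ∣ s ∣ ≡ 3 → s ≢ t → T (edge H s)) → edgesIn H S ≡ 3
  edgesIn≡3 {S} {t} ∣S∣≡4 t⊆S ∣t∣≡3 t∉E others = suc-injective (begin
    1 + edgesIn H S
      ≡⟨ cong₂ _+_ t-once (countᵇ-cong other⇒edge edge⇒other (allSubsets n)) ⟨
    countᵇ (λ s → triple s ∧ does (s ≟ˢ t)) (allSubsets n) +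
    countᵇ (λ s → triple s ∧ not (does (s ≟ˢ t))) (allSubsets n)
      ≡⟨ countᵇ-split triple (λ s → does (s ≟ˢ t)) (allSubsets n) ⟨
    countᵇ triple (allSubsets n)
      ≡⟨ countᵇ-⊆∧∣∣≡-allSubsets n S 3 ⟩
    ∣ S ∣ C 3
      ≡⟨ cong (_C 3) ∣S∣≡4 ⟩
    4 ∎)
    where
    open ≡-Reasoning
    triple : Subset n → Bool
    triple s = s ⊆ᵇ S ∧ (∣ s ∣ ≡ᵇ 3)

    ≡t⇒triple : ∀ {s} → T (does (s ≟ˢ t)) → T (triple s ∧ does (s ≟ˢ t))
    ≡t⇒triple {s} s≡t with s ≟ˢ t
    ... | yes refl = from T-∧ (from T-∧ (⊆⇒⊆ᵇ t⊆S , ≡⇒≡ᵇ _ _ ∣t∣≡3) , _)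

    t-once : countᵇ (λ s → triple s ∧ does (s ≟ˢ t)) (allSubsets n) ≡ 1
    t-once = trans (countᵇ-cong (λ {s} → proj₂ ∘ to (T-∧ {triple s})) (λ {s} → ≡t⇒triple {s})
                                (allSubsets n))
                   (countᵇ-≟-allSubsets n t)

    edge⇒other : ∀ {s} → T (s ⊆ᵇ S ∧ edge H s) → T (triple s ∧ not (does (s ≟ˢ t)))
    edge⇒other {s} h with to T-∧ h | s ≟ˢ t
    ... | _   , t-edge | yes refl = contradiction t-edge t∉E
    ... | s⊆S , s-edge | no  _    =
      from T-∧ (from T-∧ (s⊆S , ≡⇒≡ᵇ _ _ (edge-size H s s-edge)) , _)

    other⇒edge : ∀ {s} → T (triple s ∧ not (does (s ≟ˢ t))) → T (s ⊆ᵇ S ∧ edge H s)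
    other⇒edge {s} h with s ≟ˢ t
    ... | yes _  = contradiction (proj₂ (to (T-∧ {triple s}) h)) λ ()
    ... | no s≢t =
      let s⊆S , ∣s∣≡3 = to T-∧ (proj₁ (to T-∧ h))
      in  from T-∧ (s⊆S , others (⊆ᵇ⇒⊆ s⊆S) (≡ᵇ⇒≡ _ _ ∣s∣≡3) s≢t)

  IsEven⇒edge : IsEven H → ∀ {S t} → ∣ S ∣ ≡ 4 → t ⊆ S → ∣ t ∣ ≡ 3 →
                (∀ {s} → s ⊆ S → ∣ s ∣ ≡ 3 → s ≢ t → T (edge H s)) → T (edge H t)
  IsEven⇒edge even {S} {t} ∣S∣≡4 t⊆S ∣t∣≡3 others with T? (edge H t)
  ... | yes t-edge = t-edge
  ... | no  t∉E    =
    contradiction (subst (λ k → k % 2 ≡ 0) (edgesIn≡3 ∣S∣≡4 t⊆S ∣t∣≡3 t∉E others) (even S ∣S∣≡4))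
                  λ ()

module Cone {n : ℕ} (H : Hypergraph3 n) (v : Fin n) {C : Subset n} (v∉C : v ∉ C)
  (link-edge : ∀ {a b} → a ∈ C → b ∈ C → a ≢ b → T (edge H (⁅ v ⁆ ∪ ⁅ a ⁆ ∪ ⁅ b ⁆))) where

  apex-triple-edge : ∀ {t} → t ⊆ ⁅ v ⁆ ∪ C → ∣ t ∣ ≡ 3 → v ∈ t → T (edge H t)
  apex-triple-edge {t} t⊆vC ∣t∣≡3 v∈t
    with ∣p∣≡2⇒p≡⁅a⁆∪⁅b⁆ (suc-injective (trans (sym (∣p∣≡1+∣p-x∣ v∈t)) ∣t∣≡3))
  ... | a , b , a≢b , t-v≡ab = subst (T ∘ edge H) vab≡t
    (link-edge (ab⊆C (x∈p∪q⁺ (inj₁ (x∈⁅x⁆ a)))) (ab⊆C (x∈p∪q⁺ (inj₂ (x∈⁅x⁆ b)))) a≢b)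
    where
    vab≡t : ⁅ v ⁆ ∪ ⁅ a ⁆ ∪ ⁅ b ⁆ ≡ t
    vab≡t = trans (cong (⁅ v ⁆ ∪_) (sym t-v≡ab)) (⁅x⁆∪[p-x]≡p v∈t)
    ab⊆C : ⁅ a ⁆ ∪ ⁅ b ⁆ ⊆ C
    ab⊆C = subst (_⊆ C) t-v≡ab (p⊆⁅x⁆∪q∧x∉p⇒p⊆q (⊆-trans (p─q⊆p t ⁅ v ⁆) t⊆vC) (x∉p-x v))

  base-triple-edge : IsEven H → ∀ {t} → t ⊆ C → ∣ t ∣ ≡ 3 → T (edge H t)
  base-triple-edge even {t} t⊆C ∣t∣≡3 =
    IsEven⇒edge H even (trans (∣⁅x⁆∪p∣≡1+∣p∣ v∉t) (cong suc ∣t∣≡3)) (q⊆p∪q ⁅ v ⁆ t) ∣t∣≡3 others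
    where
    v∉t : v ∉ t
    v∉t = v∉C ∘ t⊆C
    others : ∀ {s} → s ⊆ ⁅ v ⁆ ∪ t → ∣ s ∣ ≡ 3 → s ≢ t → T (edge H s)
    others {s} s⊆vt ∣s∣≡3 s≢t with v ∈? s
    ... | yes v∈s = apex-triple-edge (⊆-trans s⊆vt (⁅x⁆∪-monoʳ v t⊆C)) ∣s∣≡3 v∈s
    ... | no  v∉s = contradiction (⊆∧∣q∣≤∣p∣⇒p≡q (p⊆⁅x⁆∪q∧x∉p⇒p⊆q s⊆vt v∉s)
                                                 (≤-reflexive (trans ∣t∣≡3 (sym ∣s∣≡3)))) s≢t

  cone-isCliqueᴴ : IsEven H → T (isCliqueᴴ H (⁅ v ⁆ ∪ C))
  cone-isCliqueᴴ even = isCliqueᴴ⁺ H triple-edge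
    where
    triple-edge : ∀ {t} → t ⊆ ⁅ v ⁆ ∪ C → ∣ t ∣ ≡ 3 → T (edge H t)
    triple-edge {t} t⊆vC ∣t∣≡3 with v ∈? t
    ... | yes v∈t = apex-triple-edge t⊆vC ∣t∣≡3 v∈t
    ... | no  v∉t = base-triple-edge even (p⊆⁅x⁆∪q∧x∉p⇒p⊆q t⊆vC v∉t) ∣t∣≡3

  1+∣C∣≤ωᴴ : IsEven H → suc ∣ C ∣ ≤ ωᴴ H
  1+∣C∣≤ωᴴ even = subst (_≤ ωᴴ H) (∣⁅x⁆∪p∣≡1+∣p∣ v∉C) (isCliqueᴴ⇒∣S∣≤ωᴴ H (cone-isCliqueᴴ even))

module _ {n : ℕ} {G : Graph n} {C : Subset n} (C-clique : T (isCliqueᴳ G C)) where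

  isCliqueᴳ⇒⊆verts : C ⊆ verts G
  isCliqueᴳ⇒⊆verts = ⊆ᵇ⇒⊆ (proj₁ (to T-∧ C-clique))

  isCliqueᴳ⇒adj : ∀ {a b} → a ∈ C → b ∈ C → a ≢ b → T (adj G a b)
  isCliqueᴳ⇒adj {a} {b} a∈C b∈C a≢b =
    T-not-∨⁻ ab-pair (from T-∧ (∈⇒∈ᵇ a∈C , from T-∧ (∈⇒∈ᵇ b∈C , fromWitnessFalse a≢b)))
    where
    pairs = all⁺ _ _ (proj₂ (to T-∧ C-clique))
    ab-pair = All.lookup (all⁺ _ _ (All.lookup pairs (∈-allFin a))) (∈-allFin b)

ωᴳ< : ∀ {n} {G : Graph n} {w} → 0 < w → (∀ {C} → T (isCliqueᴳ G C) → ∣ C ∣ < w) → ωᴳ G < w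
ωᴳ< {n} {G} 0<w bound =
  maxList< 0<w (map⁺ (All.map (λ {C} → bound {C}) (all-filter (T? ∘ isCliqueᴳ G) (allSubsets n))))

module _ {n : ℕ} (H : Hypergraph3 n) (v : Fin n) where

  v∉link : v ∉ verts (link H v)
  v∉link v∈link = toWitnessFalse {a? = v ≟ v} (proj₁ (to (T-∧ {not (v ≟ᵇ v)}) v-vert)) refl
    where
    v-vert : T (not (v ≟ᵇ v) ∧ any (λ e → edge H e ∧ v ∈ᵇ e ∧ v ∈ᵇ e) (allSubsets n))
    v-vert = subst T (lookup∘tabulate _ v) (from T-≡ ([]=⇒lookup v∈link))

  link-adj⇒edge : ∀ {a b} → T (adj (link H v) a b) → T (edge H (⁅ v ⁆ ∪ ⁅ a ⁆ ∪ ⁅ b ⁆))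
  link-adj⇒edge = proj₂ ∘ to T-∧

lemma2 : ∀ (n : ℕ) (H : Hypergraph3 n) → IsEven H →
           ∀ (v : Fin n) → suc (ωᴳ (link H v)) ≤ ωᴴ H
lemma2 n H even v = ωᴳ< {G = link H v} 0<ωᴴ (λ {C} → link-clique-bound {C})
  where
  link-clique-bound : ∀ {C} → T (isCliqueᴳ (link H v) C) → suc ∣ C ∣ ≤ ωᴴ H
  link-clique-bound {C} C-clique = Cone.1+∣C∣≤ωᴴ H v
    (v∉link H v ∘ isCliqueᴳ⇒⊆verts {C = C} C-clique)
    (λ a∈C b∈C a≢b → link-adj⇒edge H v (isCliqueᴳ⇒adj {G = link H v} {C} C-clique a∈C b∈C a≢b))
    even

  0<ωᴴ : 0 < ωᴴ H
  0<ωᴴ = subst (λ k → suc k ≤ ωᴴ H) (∣⊥∣≡0 n)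
    (Cone.1+∣C∣≤ωᴴ H v ∉⊥ (λ a∈⊥ → contradiction a∈⊥ ∉⊥) even)
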